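{- Let $(r,k)$ be a bounding state satisfying invariants (I1) and (I2), let $i\in\{1,\dots,n-1\}$ and $c\in\{0,1\}$. Then the bounding state $B((r,k),i,c)$ also satisfies (I1) and (I2).
   Context: Let $n\ge 2$ and let $\preceq$ be a partial order on $[n]=\{1,\dots,n\}$ such that the identity permutation is a linear extension (i.e. $a\preceq b$ implies $a\le b$). Let $*$ be a new symbol. A bounding state is a pair $(r,k)$ with $k\in[n]$ and $r=(r(1),\dots,r(n))\in(\{*\}\cup[n])^n$, whose numeric entries are distinct and at most $k$; items $1,\dots,k$ are called active. Invariants: (I1) for every $a\le k$ there is a position $j$ with $r(j)=a$; (I2) if $r(i)=a\le k$, $r(j)=b\le k$, $a\ne b$ and $a\preceq b$, then $i<j$. The bounding chain step $B((r,k),i,c)$: (1) if $c=1$ and it is not the case that $r(i),r(i+1)$ are both in $[n]$ with $r(i)\preceq r(i+1)$ (i.e. comparisons involving $*$ are always false), exchange $r(i)$ and $r(i+1)$; (2) then if $r(n)=*$, set $r(n)\leftarrow k+1$ and $k\leftarrow k+1$; return $(r,k)$. -}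

module Defs where

open import Data.Nat using (ℕ; zero; suc; _≤_; _<_; _≟_)
open import Data.Maybe using (Maybe; just; nothing)
open import Data.Product using (_×_; _,_; ∃-syntax)
open import Data.Fin using (Fin)
import Data.Fin as F
open import Data.Bool using (Bool; true; false; if_then_else_)
open import Relation.Nullary using (¬_; Dec; yes; no; does)
open import Relation.Binary.PropositionalEquality using (_≡_; _≢_)
open import Relation.Binary using (Rel; Decidable)
open import Level using (0ℓ)

-- Items and positions are natural numbers; [n] = {1,…,n}.
-- The symbol * is represented by 'nothing', an item a by 'just a'.
-- A sequence r = (r(1),…,r(n)) is a function ℕ → Maybe ℕ of which only
-- the values at positions 1,…,n matter.

InRange : ℕ → ℕ → Set
InRange n j = 1 ≤ j × j ≤ n

record IsPosetOn (n : ℕ) (_≼_ : Rel ℕ 0ℓ) : Set where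
  field
    refl≼  : ∀ a → InRange n a → a ≼ a
    antisym≼ : ∀ a b → InRange n a → InRange n b → a ≼ b → b ≼ a → a ≡ b
    trans≼ : ∀ a b c → InRange n a → InRange n b → InRange n c →
             a ≼ b → b ≼ c → a ≼ c
    linext : ∀ a b → InRange n a → InRange n b → a ≼ b → a ≤ b

Seq : Set
Seq = ℕ → Maybe ℕ

record IsBoundingState (n : ℕ) (r : Seq) (k : ℕ) : Set where
  field
    k-range   : InRange n k
    entries   : ∀ j a → InRange n j → r j ≡ just a → InRange k a
    distinct  : ∀ i j a → InRange n i → InRange n j →
                r i ≡ just a → r j ≡ just a → i ≡ j

I1 : ℕ → Seq → ℕ → Set
I1 n r k = ∀ a → InRange k a → ∃[ j ] (InRange n j × r j ≡ just a)

I2 : (_≼_ : Rel ℕ 0ℓ) → ℕ → Seq → ℕ → Set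
I2 _≼_ n r k = ∀ i j a b → InRange n i → InRange n j →
  r i ≡ just a → r j ≡ just b → a ≤ k → b ≤ k → a ≢ b → a ≼ b → i < j

related : {_≼_ : Rel ℕ 0ℓ} → Decidable _≼_ → Maybe ℕ → Maybe ℕ → Bool
related _≼?_ (just a) (just b) = does (a ≼? b)
related _≼?_ _ _ = false

swap : Seq → ℕ → Seq
swap r i j with j ≟ i
... | yes _ = r (suc i)
... | no _ with j ≟ suc i
...   | yes _ = r i
...   | no _ = r j

setAt : Seq → ℕ → Maybe ℕ → Seq
setAt r n v j with j ≟ n
... | yes _ = v
... | no _ = r j

fill : ℕ → Seq → ℕ → Seq × ℕ
fill n r k with r n
... | nothing = setAt r n (just (suc k)) , suc k
... | just _  = r , k

B : {_≼_ : Rel ℕ 0ℓ} → Decidable _≼_ → (n : ℕ) → Seq × ℕ → ℕ → Fin 2 → Seq × ℕ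
B _≼?_ n (r , k) i F.zero = fill n r k
B _≼?_ n (r , k) i (F.suc F.zero) =
  fill n (if related _≼?_ (r i) (r (suc i)) then r else swap r i) k

{-# OPTIONS --safe #-}
-- Swapping positions i and i+1 relabels positions by a transposition, which
-- preserves the bounding-state conditions and (I1); of all pairs of positions
-- it reverses the order of the swapped pair only, and for c = 1 that happens
-- only when r(i), r(i+1) are not ≼-related, so (I2) survives.  Filling an empty
-- last position is possible because (I1) then places the items 1,…,k at
-- distinct positions among 1,…,n−1, forcing k < n; the new item k+1 exceeds
-- every other active item, so as the identity is a linear extension it is ≼ none
-- of them, and it sits last, so (I2) survives too.
module Submission where

open import Defs
open import Data.Nat using (ℕ; suc; pred; _≤_; _<_; z≤n; s≤s; s≤s⁻¹; _≟_; >-nonZero)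
open import Data.Nat.Properties
open import Data.Fin using (Fin; toℕ; fromℕ<)
import Data.Fin as F
import Data.Fin.Properties as FinP
open import Data.Maybe using (just; nothing)
open import Data.Maybe.Properties using (just-injective)
open import Data.Bool using (true; false)
open import Data.Product using (_×_; _,_; proj₁; proj₂; map₂; ∃-syntax)
open import Data.Sum using (_⊎_; inj₁; inj₂)
open import Relation.Nullary using (¬_; Dec; yes; no; contradiction)
open import Relation.Nullary.Decidable using (dec-true)
open import Relation.Binary.PropositionalEquality
open import Relation.Binary using (Rel; Decidable)
open import Level using (0ℓ)
open import Function using (_∘_)
open import Function.Definitions using (Injective)

Invariants : ℕ → Rel ℕ 0ℓ → Seq → ℕ → Set
Invariants n _≼_ r k = IsBoundingState n r k × I1 n r k × I2 _≼_ n r k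

transpose : ℕ → ℕ → ℕ
transpose i j with j ≟ i
... | yes _ = suc i
... | no _ with j ≟ suc i
...   | yes _ = i
...   | no _ = j

swap≡∘transpose : ∀ r i j → swap r i j ≡ r (transpose i j)
swap≡∘transpose r i j with j ≟ i
... | yes _ = refl
... | no _ with j ≟ suc i
...   | yes _ = refl
...   | no _ = refl

transpose-i : ∀ i → transpose i i ≡ suc i
transpose-i i with i ≟ i
... | yes _ = refl
... | no i≢i = contradiction refl i≢i

transpose-suc-i : ∀ i → transpose i (suc i) ≡ i
transpose-suc-i i with suc i ≟ i
... | yes 1+i≡i = contradiction 1+i≡i 1+n≢n
... | no _ with suc i ≟ suc i
...   | yes _ = refl
...   | no 1+i≢1+i = contradiction refl 1+i≢1+i

transpose-other : ∀ {i j} → j ≢ i → j ≢ suc i → transpose i j ≡ j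
transpose-other {i} {j} j≢i j≢1+i with j ≟ i
... | yes j≡i = contradiction j≡i j≢i
... | no _ with j ≟ suc i
...   | yes j≡1+i = contradiction j≡1+i j≢1+i
...   | no _ = refl

data TransposeView (i : ℕ) : ℕ → Set where
  at-i     : TransposeView i i
  at-suc-i : TransposeView i (suc i)
  other    : ∀ {j} → j ≢ i → j ≢ suc i → TransposeView i j

transposeView : ∀ i j → TransposeView i j
transposeView i j with j ≟ i
... | yes refl = at-i
... | no j≢i with j ≟ suc i
...   | yes refl = at-suc-i
...   | no j≢1+i = other j≢i j≢1+i

transpose-involutive : ∀ i j → transpose i (transpose i j) ≡ j
transpose-involutive i j with transposeView i j
... | at-i = trans (cong (transpose i) (transpose-i i)) (transpose-suc-i i)
... | at-suc-i = trans (cong (transpose i) (transpose-suc-i i)) (transpose-i i)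
... | other j≢i j≢1+i =
  trans (cong (transpose i) (transpose-other j≢i j≢1+i)) (transpose-other j≢i j≢1+i)

transpose-inRange : ∀ {n i j} → 1 ≤ i → i < n → InRange n j → InRange n (transpose i j)
transpose-inRange {i = i} {j} 1≤i i<n j∈[n] with transposeView i j
... | at-i rewrite transpose-i i = s≤s z≤n , i<n
... | at-suc-i rewrite transpose-suc-i i = 1≤i , <⇒≤ i<n
... | other j≢i j≢1+i rewrite transpose-other j≢i j≢1+i = j∈[n]

transpose-reflects-< : ∀ i p q → transpose i p < transpose i q → p < q ⊎ (p ≡ suc i × q ≡ i)
transpose-reflects-< i p q lt with transposeView i p | transposeView i q
... | at-i | at-i = contradiction lt (<-irrefl refl)
... | at-i | at-suc-i = inj₁ (n<1+n i)
... | at-i | other q≢i q≢1+i rewrite transpose-i i | transpose-other q≢i q≢1+i =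
  inj₁ (<-trans (n<1+n i) lt)
... | at-suc-i | at-i = inj₂ (refl , refl)
... | at-suc-i | at-suc-i = contradiction lt (<-irrefl refl)
... | at-suc-i | other q≢i q≢1+i rewrite transpose-suc-i i | transpose-other q≢i q≢1+i =
  inj₁ (≤∧≢⇒< lt (q≢1+i ∘ sym))
... | other p≢i p≢1+i | at-i rewrite transpose-i i | transpose-other p≢i p≢1+i =
  inj₁ (≤∧≢⇒< (s≤s⁻¹ lt) p≢i)
... | other p≢i p≢1+i | at-suc-i rewrite transpose-suc-i i | transpose-other p≢i p≢1+i =
  inj₁ (<-trans lt (n<1+n i))
... | other p≢i p≢1+i | other q≢i q≢1+i
  rewrite transpose-other p≢i p≢1+i | transpose-other q≢i q≢1+i = inj₁ lt

module _ {n : ℕ} {π : ℕ → ℕ}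
         (π-inRange : ∀ {j} → InRange n j → InRange n (π j))
         (π-involutive : ∀ j → π (π j) ≡ j)
         {r s : Seq} (s≗r∘π : ∀ j → s j ≡ r (π j)) {k : ℕ} where

  reindex-isBoundingState : IsBoundingState n r k → IsBoundingState n s k
  reindex-isBoundingState bs = record
    { k-range  = k-range
    ; entries  = λ j a j∈[n] sj≡a → entries (π j) a (π-inRange j∈[n]) (trans (sym (s≗r∘π j)) sj≡a)
    ; distinct = λ p q a p∈[n] q∈[n] sp≡a sq≡a → begin
        p             ≡⟨ π-involutive p ⟨
        π (π p)       ≡⟨ cong π (distinct (π p) (π q) a (π-inRange p∈[n]) (π-inRange q∈[n])
                                   (trans (sym (s≗r∘π p)) sp≡a) (trans (sym (s≗r∘π q)) sq≡a)) ⟩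
        π (π q)       ≡⟨ π-involutive q ⟩
        q             ∎
    }
    where open IsBoundingState bs
          open ≡-Reasoning

  reindex-I1 : I1 n r k → I1 n s k
  reindex-I1 i1 a a∈[k] =
    let (j , j∈[n] , rj≡a) = i1 a a∈[k]
    in π j , π-inRange j∈[n] , trans (s≗r∘π (π j)) (trans (cong r (π-involutive j)) rj≡a)

module _ {n : ℕ} {_≼_ : Rel ℕ 0ℓ} {i : ℕ} (1≤i : 1 ≤ i) (i<n : i < n) {r : Seq} {k : ℕ} where

  private
    inRange : ∀ {j} → InRange n j → InRange n (transpose i j)
    inRange = transpose-inRange 1≤i i<n

    unswap : ∀ {j a} → swap r i j ≡ just a → r (transpose i j) ≡ just a
    unswap {j} = trans (sym (swap≡∘transpose r i j))

  swap-I2 : (∀ {a b} → r i ≡ just a → r (suc i) ≡ just b → ¬ a ≼ b) →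
            I2 _≼_ n r k → I2 _≼_ n (swap r i) k
  swap-I2 unrelated i2 p q a b p∈[n] q∈[n] sp≡a sq≡b a≤k b≤k a≢b a≼b
    with transpose-reflects-< i p q
           (i2 _ _ a b (inRange {p} p∈[n]) (inRange {q} q∈[n]) (unswap {p} sp≡a) (unswap {q} sq≡b)
               a≤k b≤k a≢b a≼b)
  ... | inj₁ p<q = p<q
  ... | inj₂ (refl , refl) =
    contradiction a≼b (unrelated (subst (λ j → r j ≡ just a) (transpose-suc-i i) (unswap {suc i} sp≡a))
                                 (subst (λ j → r j ≡ just b) (transpose-i i) (unswap {i} sq≡b)))

  swap-preserves : (∀ {a b} → r i ≡ just a → r (suc i) ≡ just b → ¬ a ≼ b) →
                   Invariants n _≼_ r k → Invariants n _≼_ (swap r i) k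
  swap-preserves unrelated (bs , i1 , i2) =
      reindex-isBoundingState inRange (transpose-involutive i) (swap≡∘transpose r i) bs
    , reindex-I1 inRange (transpose-involutive i) (swap≡∘transpose r i) i1
    , swap-I2 unrelated i2

related≡false⇒¬≼ : ∀ {_≼_ : Rel ℕ 0ℓ} (_≼?_ : Decidable _≼_) {x y a b} →
                   related _≼?_ x y ≡ false → x ≡ just a → y ≡ just b → ¬ a ≼ b
related≡false⇒¬≼ _≼?_ {a = a} {b} unrelated refl refl a≼b =
  contradiction (trans (sym (dec-true (a ≼? b) a≼b)) unrelated) λ ()

toFin : ∀ {m j} → InRange m j → Fin m
toFin {j = suc j} (_ , 1+j≤m) = fromℕ< 1+j≤m

toFin-injective : ∀ {m p q} (p∈[m] : InRange m p) (q∈[m] : InRange m q) →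
                  toFin p∈[m] ≡ toFin q∈[m] → p ≡ q
toFin-injective {p = suc p} {suc q} (_ , p<m) (_ , q<m) eq =
  cong suc (FinP.fromℕ<-injective p q p<m q<m eq)

I1⇒≤ : ∀ {m r k} → I1 m r k → k ≤ m
I1⇒≤ {m} {r} {k} i1 = FinP.injective⇒≤ {f = position} position-injective
  where
  item : Fin k → ℕ
  item x = suc (toℕ x)

  occurrence : (x : Fin k) → ∃[ j ] (InRange m j × r j ≡ just (item x))
  occurrence x = i1 (item x) (s≤s z≤n , FinP.toℕ<n x)

  position : Fin k → Fin m
  position x = toFin (proj₁ (proj₂ (occurrence x)))

  position-injective : Injective _≡_ _≡_ position
  position-injective {x} {y} eq = FinP.toℕ-injective (suc-injective (just-injective (begin
    just (item x)            ≡⟨ proj₂ (proj₂ (occurrence x)) ⟨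
    r (proj₁ (occurrence x)) ≡⟨ cong r (toFin-injective _ _ eq) ⟩
    r (proj₁ (occurrence y)) ≡⟨ proj₂ (proj₂ (occurrence y)) ⟩
    just (item y)            ∎)))
    where open ≡-Reasoning

occupied≢empty : ∀ {r : Seq} {n j a} → r n ≡ nothing → r j ≡ just a → j ≢ n
occupied≢empty {r} rn≡* rj≡a refl with () ← trans (sym rn≡*) rj≡a

I1-without-empty-last : ∀ {n r k} → r n ≡ nothing → I1 n r k → I1 (pred n) r k
I1-without-empty-last last-empty i1 a a∈[k] =
  let (j , (1≤j , j≤n) , rj≡a) = i1 a a∈[k]
  in j , (1≤j , <⇒≤pred (≤∧≢⇒< j≤n (occupied≢empty last-empty rj≡a))) , rj≡a

setAt-updates : ∀ r n v → setAt r n v n ≡ v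
setAt-updates r n v with n ≟ n
... | yes _ = refl
... | no n≢n = contradiction refl n≢n

setAt-minimal : ∀ r n v {j} → j ≢ n → setAt r n v j ≡ r j
setAt-minimal r n v {j} j≢n with j ≟ n
... | yes j≡n = contradiction j≡n j≢n
... | no _ = refl

module _ {n : ℕ} {_≼_ : Rel ℕ 0ℓ} (po : IsPosetOn n _≼_) {r : Seq} {k : ℕ}
         (last-empty : r n ≡ nothing) (bs : IsBoundingState n r k) (i1 : I1 n r k) where

  open IsBoundingState bs
  open IsPosetOn po using (linext)

  private
    k≤n : k ≤ n
    k≤n = proj₂ k-range

    k<n : k < n
    k<n = m≤pred[n]⇒suc[m]≤n {{>-nonZero (≤-trans (proj₁ k-range) k≤n)}}
            (I1⇒≤ (I1-without-empty-last last-empty i1))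

    r⁺ : Seq
    r⁺ = setAt r n (just (suc k))

    entry⁺ : ∀ {j a} → InRange n j → r⁺ j ≡ just a →
             (j ≡ n × a ≡ suc k) ⊎ (j ≢ n × InRange k a × r j ≡ just a)
    entry⁺ {j} {a} j∈[n] r⁺j≡a = by-position (j ≟ n)
      where
      by-position : Dec (j ≡ n) → (j ≡ n × a ≡ suc k) ⊎ (j ≢ n × InRange k a × r j ≡ just a)
      by-position (yes refl) = inj₁ (refl , just-injective (trans (sym r⁺j≡a) (setAt-updates r n _)))
      by-position (no j≢n)   = let rj≡a = trans (sym (setAt-minimal r n _ j≢n)) r⁺j≡a
                               in inj₂ (j≢n , entries j a j∈[n] rj≡a , rj≡a)

  fill-isBoundingState : IsBoundingState n r⁺ (suc k)
  fill-isBoundingState = record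
    { k-range  = s≤s z≤n , k<n
    ; entries  = entries⁺
    ; distinct = distinct⁺
    }
    where
    entries⁺ : ∀ j a → InRange n j → r⁺ j ≡ just a → InRange (suc k) a
    entries⁺ j a j∈[n] r⁺j≡a with entry⁺ j∈[n] r⁺j≡a
    ... | inj₁ (_ , refl)      = s≤s z≤n , ≤-refl
    ... | inj₂ (_ , a∈[k] , _) = map₂ m≤n⇒m≤1+n a∈[k]

    distinct⁺ : ∀ p q a → InRange n p → InRange n q → r⁺ p ≡ just a → r⁺ q ≡ just a → p ≡ q
    distinct⁺ p q a p∈[n] q∈[n] r⁺p≡a r⁺q≡a with entry⁺ p∈[n] r⁺p≡a | entry⁺ q∈[n] r⁺q≡a
    ... | inj₁ (p≡n , _)       | inj₁ (q≡n , _)       = trans p≡n (sym q≡n)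
    ... | inj₁ (_ , refl)      | inj₂ (_ , a∈[k] , _) = contradiction (proj₂ a∈[k]) 1+n≰n
    ... | inj₂ (_ , a∈[k] , _) | inj₁ (_ , refl)      = contradiction (proj₂ a∈[k]) 1+n≰n
    ... | inj₂ (_ , _ , rp≡a)  | inj₂ (_ , _ , rq≡a)  = distinct p q a p∈[n] q∈[n] rp≡a rq≡a

  fill-I1 : I1 n r⁺ (suc k)
  fill-I1 a (1≤a , a≤1+k) with a ≟ suc k
  ... | yes refl = n , (≤-trans (s≤s z≤n) k<n , ≤-refl) , setAt-updates r n _
  ... | no a≢1+k =
    let (j , j∈[n] , rj≡a) = i1 a (1≤a , s≤s⁻¹ (≤∧≢⇒< a≤1+k a≢1+k))
    in j , j∈[n] , trans (setAt-minimal r n _ (occupied≢empty last-empty rj≡a)) rj≡a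

  fill-I2 : I2 _≼_ n r k → I2 _≼_ n r⁺ (suc k)
  fill-I2 i2 p q a b p∈[n] q∈[n] r⁺p≡a r⁺q≡b _ _ a≢b a≼b
    with entry⁺ p∈[n] r⁺p≡a | entry⁺ q∈[n] r⁺q≡b
  ... | inj₁ (_ , a≡1+k) | inj₁ (_ , b≡1+k) = contradiction (trans a≡1+k (sym b≡1+k)) a≢b
  ... | inj₁ (_ , refl) | inj₂ (_ , (1≤b , b≤k) , _) =
    contradiction (≤-trans (linext a b (s≤s z≤n , k<n) (1≤b , ≤-trans b≤k k≤n) a≼b) b≤k) 1+n≰n
  ... | inj₂ (p≢n , _ , _) | inj₁ (q≡n , _) = subst (p <_) (sym q≡n) (≤∧≢⇒< (proj₂ p∈[n]) p≢n)
  ... | inj₂ (_ , (_ , a≤k) , rp≡a) | inj₂ (_ , (_ , b≤k) , rq≡b) =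
    i2 p q a b p∈[n] q∈[n] rp≡a rq≡b a≤k b≤k a≢b a≼b

fill-preserves : ∀ {n _≼_ r k} → IsPosetOn n _≼_ → Invariants n _≼_ r k →
                 Invariants n _≼_ (proj₁ (fill n r k)) (proj₂ (fill n r k))
fill-preserves {n} {r = r} po inv@(bs , i1 , i2) with r n in last
... | just _  = inv
... | nothing = fill-isBoundingState po last bs i1 , fill-I1 po last bs i1 , fill-I2 po last bs i1 i2

lemma2 : (n : ℕ) → 2 ≤ n → (_≼_ : Rel ℕ 0ℓ) → (_≼?_ : Decidable _≼_) →
    IsPosetOn n _≼_ →
    (r : Seq) (k : ℕ) → IsBoundingState n r k → I1 n r k → I2 _≼_ n r k →
    (i : ℕ) → 1 ≤ i → i < n → (c : Fin 2) →
    IsBoundingState n (proj₁ (B _≼?_ n (r , k) i c)) (proj₂ (B _≼?_ n (r , k) i c))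
    × I1 n (proj₁ (B _≼?_ n (r , k) i c)) (proj₂ (B _≼?_ n (r , k) i c))
    × I2 _≼_ n (proj₁ (B _≼?_ n (r , k) i c)) (proj₂ (B _≼?_ n (r , k) i c))
lemma2 n _ _≼_ _≼?_ po r k bs i1 i2 i 1≤i i<n F.zero = fill-preserves po (bs , i1 , i2)
lemma2 n _ _≼_ _≼?_ po r k bs i1 i2 i 1≤i i<n (F.suc F.zero)
  with related _≼?_ (r i) (r (suc i)) in relatedness
... | true  = fill-preserves po (bs , i1 , i2)
... | false = fill-preserves po (swap-preserves 1≤i i<n
                (related≡false⇒¬≼ _≼?_ relatedness) (bs , i1 , i2))
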